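{- Let $\mathcal{G}$ be a class of graphs whose membership is expressible in Monadic Second Order (MSO) logic. For every encoder $\mathcal{E}=(\mathcal{C},L,f)$, every function $g:\mathbb{N}\to\mathbb{N}$ and every integer $t\in\mathbb{N}$: if $\mathcal{E}$ is $g$-confined, then the equivalence relation $\equiv_{\mathcal{E},\mathcal{G},t}$ on $\mathcal{B}_t$ has at most $r(\mathcal{E},g,t,\mathcal{G}):=(g(t)+2)^{s_{\mathcal{E}}(t)}\cdot 2^t\cdot r_{\mathcal{G},t}$ equivalence classes. In particular, the restriction of $\equiv_{\mathcal{E},\mathcal{G},t}$ to $\mathcal{F}_t$ also has at most $r(\mathcal{E},g,t,\mathcal{G})$ equivalence classes.
   Context: Graphs are finite, simple and undirected. A boundaried graph is a graph $G$ with a set $\partial(G)\subseteq V(G)$ (its boundary) and an injective labeling $\lambda_G:\partial(G)\to\mathbb{N}$; $\Lambda(G)=\lambda_G(\partial(G))$. It is $t$-boundaried if $\Lambda(G)\subseteq\{1,\dots,t\}$. $\mathcal{B}_t$ is the set of all $t$-boundaried graphs and $\mathcal{F}_t\subseteq\mathcal{B}_t$ the set of those having a rooted tree decomposition of width $t-1$ whose root bag contains all boundary vertices. For boundaried $G_1,G_2$, $G_1\oplus G_2$ is the graph obtained from the disjoint union by identifying boundary vertices with equal labels (two identified vertices are adjacent iff they are adjacent in $G_1$ or in $G_2$). An encoder is a triple $\mathcal{E}=(\mathcal{C},L,f)$ where: $\mathcal{C}$ maps every finite $I\subseteq\mathbb{N}$ to a finite set $\mathcal{C}(I)$ of strings (encodings),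 and the size of $\mathcal{E}$ is $s_{\mathcal{E}}(t)=\max\{|\mathcal{C}(I)|: I\subseteq\{1,\dots,t\}\}$; $L$ is a computable language of triples $(G,\mathcal{S},R)$ with $G$ a boundaried graph, $\mathcal{S}$ a collection of subgraphs of $G$, and $R\in\mathcal{C}(\Lambda(G))$; $f$ is a computable function assigning to each boundaried graph $G$ and $R\in\mathcal{C}(\Lambda(G))$ a value in $\mathbb{N}\cup\{ -\infty\}$. $\mathcal{E}$ is $g$-confined if for every $t$ and every $t$-boundaried $G$, either $f(G,R)=-\infty$ for all $R\in\mathcal{C}(\Lambda(G))$, or the maximum minus the minimum of the values $f(G,R)\neq-\infty$, $R\in\mathcal{C}(\Lambda(G))$, is at most $g(t)$. For $G_1,G_2\in\mathcal{B}_t$: $G_1\equiv_{\mathcal{E},t}G_2$ if $\Lambda(G_1)=\Lambda(G_2)=:I$ and there is an integer $\Delta_{\mathcal{E}}(G_1,G_2)$ with $f(G_1,R)=f(G_2,R)-\Delta_{\mathcal{E}}(G_1,G_2)$ for all $R\in\mathcal{C}(I)$ (with $-\infty-c=-\infty$). $G_1\equiv_{\mathcal{G},t}G_2$ if either $G_1,G_2\notin\mathcal{G}$, or $G_1,G_2\in\mathcal{G}$ and for every $H\in\mathcal{B}_t$, $H\oplus G_1\in\mathcal{G}$ iff $H\oplus G_2\in\mathcal{G}$. $G_1\equiv_{\mathcal{E},\mathcal{G},t}G_2$ if both $G_1\equiv_{\mathcal{E},t}G_2$ and $G_1\equiv_{\mathcal{G},t}G_2$. $r_{\mathcal{G},t}$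 denotes the (finite) number of equivalence classes of $\equiv_{\mathcal{G},t}$. -}

module Defs where

open import Data.Bool using (Bool; true; false; _∧_; _∨_; not; T; if_then_else_)
open import Data.Bool.ListAction using (any)
open import Data.Nat using (ℕ; zero; suc; _+_; _*_; _^_; _≤_; _<_; _⊔_; _<ᵇ_)
import Data.Nat as ℕ
open import Data.Integer as ℤ using (ℤ; +_)
open import Data.Fin using (Fin; toℕ; splitAt)
open import Data.Fin.Subset using (Subset; inside; outside)
open import Data.Vec using (Vec; []; _∷_; lookup)
open import Data.List using (List; []; _∷_; map; filter; length; foldr; mapMaybe; allFin; head; _++_; concatMap)
import Data.List as List
open import Data.List.Relation.Unary.All using (All)
import Data.List.Relation.Unary.All as All
open import Data.List.Relation.Unary.Unique.Propositional using (Unique)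
open import Data.List.Relation.Unary.Linked using (Linked)
open import Data.List.Membership.Propositional using (_∈_)
open import Data.Maybe using (Maybe; just; nothing; is-just; _>>=_)
open import Data.Maybe.Properties using (≡-dec)
open import Data.Product using (Σ; _×_; _,_; ∃; ∃-syntax; proj₁; proj₂)
open import Data.Sum using (_⊎_; inj₁; inj₂)
open import Data.Empty using (⊥)
open import Data.Unit using (⊤)
open import Data.String using (String)
open import Function.Bundles using (_⇔_)
open import Relation.Nullary using (¬_; ¬?)
open import Relation.Nullary.Decidable using (T?; ⌊_⌋)
open import Relation.Binary.PropositionalEquality using (_≡_; _≢_; refl)

record Graph : Set where
  field
    n      : ℕ
    adj    : Fin n → Fin n → Bool
    sym    : ∀ u v → adj u v ≡ adj v u
    irrefl : ∀ u → adj u u ≡ false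
open Graph public

-- Boundaried graphs: a graph with an injective partial labelling
-- lab : V(G) → Maybe ℕ ; the boundary ∂(G) is the set of vertices v
-- with lab v ≡ just _, and λ_G(v) is that label.

record BGraph : Set where
  field
    graph   : Graph
    lab     : Fin (n graph) → Maybe ℕ
    lab-inj : ∀ u v l → lab u ≡ just l → lab v ≡ just l → u ≡ v
open BGraph public

-- Finite subsets of ℕ are represented by lists enumerating them;
-- two such lists denote the same set iff they have the same members.
FinSetℕ : Set
FinSetℕ = List ℕ

_≈ˢ_ : FinSetℕ → FinSetℕ → Set
I ≈ˢ J = ∀ x → (x ∈ I) ⇔ (x ∈ J)

Λ : BGraph → FinSetℕ
Λ G = mapMaybe (lab G) (allFin (n (graph G)))

tBoundaried : ℕ → BGraph → Set
tBoundaried t G = ∀ l → l ∈ Λ G → 1 ≤ l × l ≤ t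

B : ℕ → Set
B t = Σ BGraph (tBoundaried t)

-- Gluing G₁ ⊕ G₂ : disjoint union, identifying boundary vertices with
-- equal labels (adjacent iff adjacent in G₁ or in G₂).

findLabel : {m : ℕ} → (Fin m → Maybe ℕ) → ℕ → Maybe (Fin m)
findLabel {m} lb l = head (filter (λ v → ≡-dec Data.Nat._≟_ (lb v) (just l)) (allFin m))

adjM : {m : ℕ} → (Fin m → Fin m → Bool) → Maybe (Fin m) → Maybe (Fin m) → Bool
adjM a (just u) (just v) = a u v
adjM a _        _        = false

module Glue (G₁ G₂ : BGraph) where
  n₁ = n (graph G₁)
  n₂ = n (graph G₂)

  match : Fin n₂ → Maybe (Fin n₁)
  match v = lab G₂ v >>= findLabel (lab G₁)

  keep : List (Fin n₂)
  keep = filter (λ v → T? (not (is-just (match v)))) (allFin n₂)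

  N : ℕ
  N = n₁ + length keep

  rep₁ : Fin N → Maybe (Fin n₁)
  rep₁ w with splitAt n₁ w
  ... | inj₁ u = just u
  ... | inj₂ _ = nothing

  rep₂ : Fin N → Maybe (Fin n₂)
  rep₂ w with splitAt n₁ w
  ... | inj₁ u = lab G₁ u >>= findLabel (lab G₂)
  ... | inj₂ i = just (List.lookup keep i)

  gadj : Fin N → Fin N → Bool
  gadj w w′ = adjM (adj (graph G₁)) (rep₁ w) (rep₁ w′) ∨ adjM (adj (graph G₂)) (rep₂ w) (rep₂ w′)

  private
    adjM-sym : {m : ℕ} (a : Fin m → Fin m → Bool) → (∀ u v → a u v ≡ a v u) →
               ∀ x y → adjM a x y ≡ adjM a y x
    adjM-sym a s (just u) (just v) = s u v
    adjM-sym a s (just u) nothing  = refl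
    adjM-sym a s nothing  (just v) = refl
    adjM-sym a s nothing  nothing  = refl

    adjM-irr : {m : ℕ} (a : Fin m → Fin m → Bool) → (∀ u → a u u ≡ false) →
               ∀ x → adjM a x x ≡ false
    adjM-irr a i (just u) = i u
    adjM-irr a i nothing  = refl

  gsym : ∀ u v → gadj u v ≡ gadj v u
  gsym u v rewrite adjM-sym (adj (graph G₁)) (Graph.sym (graph G₁)) (rep₁ u) (rep₁ v)
                 | adjM-sym (adj (graph G₂)) (Graph.sym (graph G₂)) (rep₂ u) (rep₂ v) = refl

  girr : ∀ u → gadj u u ≡ false
  girr u rewrite adjM-irr (adj (graph G₁)) (irrefl (graph G₁)) (rep₁ u)
               | adjM-irr (adj (graph G₂)) (irrefl (graph G₂)) (rep₂ u) = refl

  glued : Graph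
  glued = record { n = N ; adj = gadj ; sym = gsym ; irrefl = girr }

_⊕_ : BGraph → BGraph → Graph
G₁ ⊕ G₂ = Glue.glued G₁ G₂

_∈ₛ_ : {m : ℕ} → Fin m → Subset m → Bool
v ∈ₛ S = lookup S v

record Subgraph (G : Graph) : Set where
  field
    vs  : Subset (n G)
    es  : Fin (n G) → Fin (n G) → Bool
    es⊆ : ∀ u v → es u v ≡ true → (adj G u v ≡ true) × (u ∈ₛ vs ≡ true) × (v ∈ₛ vs ≡ true)
    es-sym : ∀ u v → es u v ≡ es v u

data ℕ⁻∞ : Set where
  -∞  : ℕ⁻∞
  fin : ℕ → ℕ⁻∞

record Encoder : Set₁ where
  field
    C        : FinSetℕ → List String
    C-unique : ∀ I → Unique (C I)
    C-resp   : ∀ {I J} → I ≈ˢ J → ∀ R → (R ∈ C I) ⇔ (R ∈ C J)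
    L        : (G : BGraph) → List (Subgraph (graph G)) → String → Bool
    f        : BGraph → String → ℕ⁻∞
open Encoder public

allSubsets : (m : ℕ) → List (Subset m)
allSubsets zero    = [] ∷ []
allSubsets (suc m) = map (inside ∷_) (allSubsets m) ++ map (outside ∷_) (allSubsets m)

toLabels : {t : ℕ} → Subset t → FinSetℕ
toLabels {t} S = mapMaybe (λ i → if i ∈ₛ S then just (suc (toℕ i)) else nothing) (allFin t)

size : Encoder → ℕ → ℕ
size E t = foldr _⊔_ 0 (map (λ S → length (C E (toLabels S))) (allSubsets t))

Confined : (ℕ → ℕ) → Encoder → Set
Confined g E = ∀ t (G : B t) R R′ a b →
  R ∈ C E (Λ (proj₁ G)) → R′ ∈ C E (Λ (proj₁ G)) →
  f E (proj₁ G) R ≡ fin a → f E (proj₁ G) R′ ≡ fin b → a ≤ b + g t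

ShiftEq : ℕ⁻∞ → ℕ⁻∞ → ℤ → Set
ShiftEq -∞      -∞      Δ = ⊤
ShiftEq (fin a) (fin b) Δ = + a ≡ (+ b) ℤ.- Δ
ShiftEq _       _       Δ = ⊥

_≡[_,_]_ : ∀ {t} → B t → Encoder → ℕ → B t → Set
G₁ ≡[ E , t ] G₂ =
  (Λ (proj₁ G₁) ≈ˢ Λ (proj₁ G₂)) ×
  (∃[ Δ ] ∀ R → R ∈ C E (Λ (proj₁ G₁)) → ShiftEq (f E (proj₁ G₁) R) (f E (proj₁ G₂) R) Δ)

_≡𝓖[_,_]_ : ∀ {t} → B t → (Graph → Set) → ℕ → B t → Set
G₁ ≡𝓖[ 𝓖 , t ] G₂ =
  (¬ 𝓖 (graph (proj₁ G₁)) × ¬ 𝓖 (graph (proj₁ G₂))) ⊎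
  (𝓖 (graph (proj₁ G₁)) × 𝓖 (graph (proj₁ G₂)) ×
    ((H : B t) → 𝓖 (proj₁ H ⊕ proj₁ G₁) ⇔ 𝓖 (proj₁ H ⊕ proj₁ G₂)))

_≡[_,_,_]_ : ∀ {t} → B t → Encoder → (Graph → Set) → ℕ → B t → Set
G₁ ≡[ E , 𝓖 , t ] G₂ = (G₁ ≡[ E , t ] G₂) × (G₁ ≡𝓖[ 𝓖 , t ] G₂)

ExactlyClasses : (A : Set) → (A → A → Set) → ℕ → Set
ExactlyClasses A _≈_ r =
  Σ (Fin r → A) λ rep →
    (∀ i j → rep i ≈ rep j → i ≡ j) × (∀ x → ∃[ i ] (x ≈ rep i))

AtMostClasses : (A : Set) → (A → A → Set) → ℕ → Set
AtMostClasses A _≈_ N =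
  (xs : Fin (suc N) → A) → ∃[ i ] ∃[ j ] (i ≢ j × xs i ≈ xs j)

-- Monadic second-order logic on graphs (MSO₂: quantification over
-- vertices, edges, vertex sets and edge sets; atoms adjacency,
-- incidence, equality, membership).

data Sort : Set where
  vtx edg vset eset : Sort

data Formula (Γ : List Sort) : Set where
  adjF  : vtx ∈ Γ → vtx ∈ Γ → Formula Γ
  incF  : edg ∈ Γ → vtx ∈ Γ → Formula Γ
  eqV   : vtx ∈ Γ → vtx ∈ Γ → Formula Γ
  eqE   : edg ∈ Γ → edg ∈ Γ → Formula Γ
  memV  : vtx ∈ Γ → vset ∈ Γ → Formula Γ
  memE  : edg ∈ Γ → eset ∈ Γ → Formula Γ
  notF  : Formula Γ → Formula Γ
  andF  : Formula Γ → Formula Γ → Formula Γ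
  exF   : (s : Sort) → Formula (s ∷ Γ) → Formula Γ

edges : (G : Graph) → List (Fin (n G) × Fin (n G))
edges G = filter (λ e → T? (adj G (proj₁ e) (proj₂ e) ∧ (toℕ (proj₁ e) <ᵇ toℕ (proj₂ e))))
                 (concatMap (λ u → map (u ,_) (allFin (n G))) (allFin (n G)))

module _ (G : Graph) where
  m : ℕ
  m = length (edges G)

  endpoints : Fin m → Fin (n G) × Fin (n G)
  endpoints e = List.lookup (edges G) e

  ⟦_⟧ : Sort → Set
  ⟦ vtx  ⟧ = Fin (n G)
  ⟦ edg  ⟧ = Fin m
  ⟦ vset ⟧ = Subset (n G)
  ⟦ eset ⟧ = Subset m

  domain : (s : Sort) → List ⟦ s ⟧
  domain vtx  = allFin (n G)
  domain edg  = allFin m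
  domain vset = allSubsets (n G)
  domain eset = allSubsets m

  finEq : {k : ℕ} → Fin k → Fin k → Bool
  finEq x y = ⌊ x Data.Fin.≟ y ⌋

  eval : ∀ {Γ} → Formula Γ → All ⟦_⟧ Γ → Bool
  eval (adjF x y)   ρ = adj G (All.lookup ρ x) (All.lookup ρ y)
  eval (incF e x)   ρ = finEq (proj₁ (endpoints (All.lookup ρ e))) (All.lookup ρ x)
                      ∨ finEq (proj₂ (endpoints (All.lookup ρ e))) (All.lookup ρ x)
  eval (eqV x y)    ρ = finEq (All.lookup ρ x) (All.lookup ρ y)
  eval (eqE x y)    ρ = finEq (All.lookup ρ x) (All.lookup ρ y)
  eval (memV x X)   ρ = All.lookup ρ x ∈ₛ All.lookup ρ X
  eval (memE e Y)   ρ = All.lookup ρ e ∈ₛ All.lookup ρ Y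
  eval (notF φ)     ρ = not (eval φ ρ)
  eval (andF φ ψ)   ρ = eval φ ρ ∧ eval ψ ρ
  eval (exF s φ)    ρ = any (λ d → eval φ (d All.∷ ρ)) (domain s)

_⊨_ : Graph → Formula [] → Set
G ⊨ φ = eval G φ All.[] ≡ true

MSOExpressible : (Graph → Set) → Set
MSOExpressible 𝓖 = ∃[ φ ] ∀ G → 𝓖 G ⇔ (G ⊨ φ)

data Walk (T : Graph) (P : Fin (n T) → Bool) : Fin (n T) → Fin (n T) → Set where
  here : ∀ {a} → P a ≡ true → Walk T P a a
  step : ∀ {a b c} → P a ≡ true → adj T a b ≡ true → Walk T P b c → Walk T P a c

ConnectedOn : (T : Graph) → (Fin (n T) → Bool) → Set
ConnectedOn T P = ∀ a b → P a ≡ true → P b ≡ true → Walk T P a b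

lastOr : {A : Set} → A → List A → A
lastOr a []       = a
lastOr a (b ∷ bs) = lastOr b bs

record Cycle (T : Graph) : Set where
  field
    first  : Fin (n T)
    rest   : List (Fin (n T))
    len    : 2 ≤ length rest
    distinct : Unique (first ∷ rest)
    path   : Linked (λ u v → adj T u v ≡ true) (first ∷ rest)
    closes : adj T (lastOr first rest) first ≡ true

IsTree : Graph → Set
IsTree T = (1 ≤ n T) × ConnectedOn T (λ _ → true) × ¬ Cycle T

-- rooted tree decomposition of G of width at most k-1 (bags of size
-- at most k) whose root bag contains all boundary vertices of G
record RootedTD (k : ℕ) (G : BGraph) : Set where
  field
    tree    : Graph
    isTree  : IsTree tree
    root    : Fin (n tree)
    bag     : Fin (n tree) → Subset (n (graph G))
    vcover  : ∀ v → ∃[ x ] (v ∈ₛ bag x ≡ true)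
    ecover  : ∀ u v → adj (graph G) u v ≡ true → ∃[ x ] ((u ∈ₛ bag x ≡ true) × (v ∈ₛ bag x ≡ true))
    connect : ∀ v → ConnectedOn tree (λ x → v ∈ₛ bag x)
    width   : ∀ x → Data.Fin.Subset.∣ bag x ∣ ≤ k
    rootBd  : ∀ v l → lab G v ≡ just l → v ∈ₛ bag root ≡ true

F : ℕ → Set
F t = Σ (B t) λ G → RootedTD t (proj₁ G)

-- the bound r(𝓔,g,t,𝓖) given r = r_{𝓖,t}
bound : Encoder → (ℕ → ℕ) → ℕ → ℕ → ℕ
bound E g t r = (g t + 2) ^ size E t * 2 ^ t * r

-- The ≡_{𝓔,t}-class of a t-boundaried graph G is determined by two pieces
-- of data: its label set Λ(G) ⊆ {1,…,t} (2^t choices), and, for each of the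
-- at most s_𝓔(t) encodings R, the value f(G,R) measured from the least
-- finite value m_G.  By confinement f(G,R) − m_G ∈ {0,…,g(t)}, so together
-- with -∞ every encoding contributes one of g(t)+2 possibilities: two graphs
-- with the same data differ by the shift Δ = m_{G₂} − m_{G₁}.  Pairing this
-- data with the ≡_{𝓖,t}-class gives a map into a set with r(𝓔,g,t,𝓖)
-- elements that identifies only equivalent graphs; conclude by pigeonhole.
module Submission where

open import Defs
open import Data.Bool using (true; false; if_then_else_)
open import Data.Empty using (⊥-elim)
open import Data.Fin using (Fin; toℕ; fromℕ<; combine; funToFin; finToFun; inject≤)
import Data.Fin.Properties as Finₚ
open import Data.Fin.Subset using (Subset)
open import Data.Integer as ℤ using (+_)
open import Data.Integer.Properties using (pos-+)
open import Data.Integer.Tactic.RingSolver using (solve-∀)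
open import Data.List using (List; []; _∷_; mapMaybe; map; length; foldr; allFin)
open import Data.List.Extrema.Nat using (min; argmin-sel; min≤⊤; min≤xs)
open import Data.List.Membership.Propositional using (_∈_)
open import Data.List.Membership.Propositional.Properties using (∈-allFin; ∈-map⁺; ∈-++⁺ˡ; ∈-++⁺ʳ)
open import Data.List.Relation.Unary.Any using (here; there; index)
import Data.List.Relation.Unary.All as All
open import Data.Maybe using (Maybe; just; nothing; maybe)
open import Data.Nat using (ℕ; zero; suc; _+_; _*_; _≤_; _<_; _∸_; _⊓_; _⊔_; _^_; s≤s; z≤n; z<s)
open import Data.Nat.Properties as ℕₚ using (_≟_)
open import Data.List.Membership.DecPropositional _≟_ using (_∈?_)
open import Data.Product using (Σ; _×_; _,′_; proj₁; proj₂; map₁; map₂; ∃-syntax)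
open import Data.String using (String)
open import Data.Sum using (inj₁; inj₂)
open import Data.Unit using (⊤; tt)
open import Data.Vec using ([]; _∷_; lookup; tabulate)
open import Data.Vec.Properties using (lookup∘tabulate; tabulate-cong; tabulate∘lookup)
open import Function using (_∘_)
open import Function.Bundles using (_⇔_; mk⇔; Equivalence; Inverse)
import Function.Properties.Equivalence as ⇔
open import Relation.Binary.PropositionalEquality as ≡
  using (_≡_; refl; cong; subst; _≗_; module ≡-Reasoning)
open import Relation.Nullary using (yes; no)
open import Relation.Nullary.Decidable using (⌊_⌋)

open ≡-Reasoning

-- `_,_` stays out of the top-level scope, where it would make the
-- `_ ≡[ E , 𝓖 , t ] _` in the statement of lemma3p5 ambiguous.
module _ where
  open import Data.Product using (_,_)

  Classifier : (A : Set) → (A → A → Set) → ℕ → Set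
  Classifier A _≈_ N = Σ (A → Fin N) λ key → ∀ x y → key x ≡ key y → x ≈ y

  module _ {A : Set} where

    classifier⇒atMostClasses : ∀ {_≈_ : A → A → Set} {N} →
      Classifier A _≈_ N → AtMostClasses A _≈_ N
    classifier⇒atMostClasses (key , separates) xs
      with i , j , i<j , same ← Finₚ.pigeonhole (ℕₚ.n<1+n _) (key ∘ xs)
      = i , j , Finₚ.<⇒≢ i<j , separates (xs i) (xs j) same

    classifier-× : ∀ {_≈₁_ _≈₂_ : A → A → Set} {a b} →
      Classifier A _≈₁_ a → Classifier A _≈₂_ b →
      Classifier A (λ x y → x ≈₁ y × x ≈₂ y) (a * b)
    classifier-× (key₁ , separates₁) (key₂ , separates₂) =
      (λ x → combine (key₁ x) (key₂ x)) ,
      λ x y same → let same₁ , same₂ = Finₚ.combine-injective _ _ _ _ same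
                   in separates₁ x y same₁ , separates₂ x y same₂

    exactlyClasses⇒classifier : ∀ {_≈_ : A → A → Set} {r} → ExactlyClasses A _≈_ r →
      (∀ x y z → x ≈ z → y ≈ z → x ≈ y) → Classifier A _≈_ r
    exactlyClasses⇒classifier {_≈_} (rep , _ , covered) euclidean =
      proj₁ ∘ covered ,
      λ x y same → euclidean x y _ (proj₂ (covered x))
                             (subst (λ i → y ≈ rep i) (≡.sym same) (proj₂ (covered y)))

  module _ {𝓖 : Graph → Set} {t : ℕ} where

    ≡𝓖-euclidean : ∀ (G₁ G₂ G₃ : B t) →
      G₁ ≡𝓖[ 𝓖 , t ] G₃ → G₂ ≡𝓖[ 𝓖 , t ] G₃ → G₁ ≡𝓖[ 𝓖 , t ] G₂
    ≡𝓖-euclidean _ _ _ (inj₁ (∉₁ , _))         (inj₁ (∉₂ , _))     = inj₁ (∉₁ , ∉₂)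
    ≡𝓖-euclidean _ _ _ (inj₁ (_ , ∉₃))         (inj₂ (_ , ∈₃ , _)) = ⊥-elim (∉₃ ∈₃)
    ≡𝓖-euclidean _ _ _ (inj₂ (_ , ∈₃ , _))     (inj₁ (_ , ∉₃))     = ⊥-elim (∉₃ ∈₃)
    ≡𝓖-euclidean _ _ _ (inj₂ (∈₁ , _ , glue₁)) (inj₂ (∈₂ , _ , glue₂)) =
      inj₂ (∈₁ , ∈₂ , λ H → ⇔.trans (glue₁ H) (⇔.sym (glue₂ H)))

  module _ {A C : Set} (h : A → Maybe C) where

    ∈-mapMaybe⁺ : ∀ {xs x y} → x ∈ xs → h x ≡ just y → y ∈ mapMaybe h xs
    ∈-mapMaybe⁺ {x ∷ xs} (here refl) hx≡y with h x
    ... | just _ with refl ← hx≡y = here refl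
    ∈-mapMaybe⁺ {x ∷ xs} (there x∈xs) hx≡y with h x
    ... | nothing = ∈-mapMaybe⁺ x∈xs hx≡y
    ... | just _  = there (∈-mapMaybe⁺ x∈xs hx≡y)

    ∈-mapMaybe⁻ : ∀ xs {y} → y ∈ mapMaybe h xs → ∃[ x ] (x ∈ xs × h x ≡ just y)
    ∈-mapMaybe⁻ (x ∷ xs) y∈ with h x in hx | y∈
    ... | nothing | y∈′       = map₂ (map₁ there) (∈-mapMaybe⁻ xs y∈′)
    ... | just _  | here refl = x , here refl , hx
    ... | just _  | there y∈′ = map₂ (map₁ there) (∈-mapMaybe⁻ xs y∈′)

  lookupMaybe : {A : Set} → List A → ℕ → Maybe A
  lookupMaybe []       _       = nothing
  lookupMaybe (x ∷ xs) zero    = just x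
  lookupMaybe (x ∷ xs) (suc i) = lookupMaybe xs i

  lookupMaybe-index : {A : Set} {xs : List A} {x : A} (x∈xs : x ∈ xs) →
                      lookupMaybe xs (toℕ (index x∈xs)) ≡ just x
  lookupMaybe-index (here refl) = refl
  lookupMaybe-index (there x∈xs) = lookupMaybe-index x∈xs

  ≤-foldr-⊔ : ∀ {x xs} → x ∈ xs → x ≤ foldr _⊔_ 0 xs
  ≤-foldr-⊔ {xs = x ∷ xs} (here refl)  = ℕₚ.m≤m⊔n x _
  ≤-foldr-⊔ {xs = y ∷ xs} (there x∈xs) = ℕₚ.≤-trans (≤-foldr-⊔ x∈xs) (ℕₚ.m≤n⊔m y _)

  minimum : List ℕ → ℕ
  minimum []       = 0
  minimum (x ∷ xs) = min x xs

  minimum-≤ : ∀ {x xs} → x ∈ xs → minimum xs ≤ x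
  minimum-≤ {xs = y ∷ ys} (here refl) = min≤⊤ y ys
  minimum-≤ {xs = y ∷ ys} (there x∈) = All.lookup (min≤xs y ys) x∈

  minimum-∈ : ∀ {x xs} → x ∈ xs → minimum xs ∈ xs
  minimum-∈ {xs = y ∷ ys} _ with argmin-sel (λ z → z) y ys
  ... | inj₁ eq = here eq
  ... | inj₂ m∈ = there m∈

  ∈-allSubsets : ∀ {n} (S : Subset n) → S ∈ allSubsets n
  ∈-allSubsets []                       = here refl
  ∈-allSubsets {suc n} (true ∷ S)  = ∈-++⁺ˡ (∈-map⁺ (true ∷_) (∈-allSubsets S))
  ∈-allSubsets {suc n} (false ∷ S) =
    ∈-++⁺ʳ (map (true ∷_) (allSubsets n)) (∈-map⁺ (false ∷_) (∈-allSubsets S))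

  funToFin-injective : ∀ {m n} {h₁ h₂ : Fin m → Fin n} →
                       funToFin h₁ ≡ funToFin h₂ → h₁ ≗ h₂
  funToFin-injective {h₁ = h₁} {h₂} same i = begin
    h₁ i                    ≡⟨ Finₚ.finToFun-funToFin h₁ i ⟨
    finToFun (funToFin h₁) i ≡⟨ cong (λ c → finToFun c i) same ⟩
    finToFun (funToFin h₂) i ≡⟨ Finₚ.finToFun-funToFin h₂ i ⟩
    h₂ i                    ∎

  subsetIndex : ∀ {n} → Subset n → Fin (2 ^ n)
  subsetIndex S = funToFin (Inverse.from Finₚ.2↔Bool ∘ lookup S)

  subsetIndex-injective : ∀ {n} {S S′ : Subset n} → subsetIndex S ≡ subsetIndex S′ → S ≡ S′
  subsetIndex-injective {S = S} {S′} same = begin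
    S                  ≡⟨ tabulate∘lookup S ⟨
    tabulate (lookup S)  ≡⟨ tabulate-cong (λ i → bit-injective (funToFin-injective same i)) ⟩
    tabulate (lookup S′) ≡⟨ tabulate∘lookup S′ ⟩
    S′                 ∎
    where
      open Inverse Finₚ.2↔Bool using (to; from; strictlyInverseˡ)
      bit-injective : ∀ {b b′} → from b ≡ from b′ → b ≡ b′
      bit-injective {b} {b′} eq = begin
        b           ≡⟨ strictlyInverseˡ b ⟨
        to (from b)  ≡⟨ cong to eq ⟩
        to (from b′) ≡⟨ strictlyInverseˡ b′ ⟩
        b′          ∎

  labelSubset : (t : ℕ) → FinSetℕ → Subset t
  labelSubset t I = tabulate λ i → ⌊ suc (toℕ i) ∈? I ⌋

  module _ {t : ℕ} {I : FinSetℕ} where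

    private
      labelAt : Fin t → Maybe ℕ
      labelAt i = if lookup (labelSubset t I) i then just (suc (toℕ i)) else nothing

      labelAt-∈ : ∀ i → suc (toℕ i) ∈ I → labelAt i ≡ just (suc (toℕ i))
      labelAt-∈ i i∈I rewrite lookup∘tabulate (λ i → ⌊ suc (toℕ i) ∈? I ⌋) i
        with suc (toℕ i) ∈? I
      ... | yes _   = refl
      ... | no i∉I  = ⊥-elim (i∉I i∈I)

      labelAt-just : ∀ {i l} → labelAt i ≡ just l → l ∈ I
      labelAt-just {i} labelled rewrite lookup∘tabulate (λ i → ⌊ suc (toℕ i) ∈? I ⌋) i
        with suc (toℕ i) ∈? I
      ... | yes i∈I with refl ← labelled = i∈I
      ... | no _    with () ← labelled

    toLabels-labelSubset : (∀ l → l ∈ I → 1 ≤ l × l ≤ t) → I ≈ˢ toLabels (labelSubset t I)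
    toLabels-labelSubset inRange l = mk⇔ into back
      where
        into : l ∈ I → l ∈ toLabels (labelSubset t I)
        into l∈I with inRange l l∈I
        ... | s≤s z≤n , l≤t =
          ∈-mapMaybe⁺ labelAt (∈-allFin i)
            (subst (λ k → labelAt i ≡ just k) 1+i≡l
                   (labelAt-∈ i (subst (_∈ I) (≡.sym 1+i≡l) l∈I)))
          where
            i : Fin t
            i = fromℕ< l≤t

            1+i≡l : suc (toℕ i) ≡ l
            1+i≡l = cong suc (Finₚ.toℕ-fromℕ< l≤t)

        back : l ∈ toLabels (labelSubset t I) → l ∈ I
        back l∈ = labelAt-just (proj₂ (proj₂ (∈-mapMaybe⁻ labelAt (allFin t) l∈)))

  finite : ℕ⁻∞ → Maybe ℕ
  finite -∞      = nothing
  finite (fin a) = just a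

  finite-just : ∀ {v a} → finite v ≡ just a → v ≡ fin a
  finite-just {fin a} refl = refl

  InWindow : ℕ → ℕ → ℕ⁻∞ → Set
  InWindow k m -∞      = ⊤
  InWindow k m (fin a) = m ≤ a × a ≤ m + k

  -- The ⊓ k only bounds the code; on values inside the window it is inert.
  offset : ℕ → ℕ → ℕ⁻∞ → ℕ
  offset k m -∞      = 0
  offset k m (fin a) = suc ((a ∸ m) ⊓ k)

  offset<k+2 : ∀ k m v → offset k m v < k + 2
  offset<k+2 k m v = subst (offset k m v <_) (ℕₚ.+-comm 2 k) (bounded v)
    where
      bounded : ∀ v → offset k m v < suc (suc k)
      bounded -∞      = z<s
      bounded (fin a) = s≤s (s≤s (ℕₚ.m⊓n≤n (a ∸ m) k))

  shift-by-∸ : ∀ {a b m n} → m ≤ a → n ≤ b → a ∸ m ≡ b ∸ n → + a ≡ + b ℤ.- (+ n ℤ.- + m)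
  shift-by-∸ {a} {b} {m} {n} m≤a n≤b same = begin
    + a                                   ≡⟨ cong +_ (ℕₚ.m∸n+n≡m m≤a) ⟨
    + (a ∸ m + m)                         ≡⟨ pos-+ (a ∸ m) m ⟩
    + (a ∸ m) ℤ.+ + m                     ≡⟨ cong (λ d → + d ℤ.+ + m) same ⟩
    + (b ∸ n) ℤ.+ + m                     ≡⟨ regroup (+ (b ∸ n)) (+ m) (+ n) ⟩
    (+ (b ∸ n) ℤ.+ + n) ℤ.- (+ n ℤ.- + m) ≡⟨ cong (ℤ._- (+ n ℤ.- + m)) (pos-+ (b ∸ n) n) ⟨
    + (b ∸ n + n) ℤ.- (+ n ℤ.- + m)       ≡⟨ cong (λ c → + c ℤ.- (+ n ℤ.- + m)) (ℕₚ.m∸n+n≡m n≤b) ⟩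
    + b ℤ.- (+ n ℤ.- + m)                 ∎
    where
      regroup : ∀ d x y → d ℤ.+ x ≡ (d ℤ.+ y) ℤ.- (y ℤ.- x)
      regroup = solve-∀

  offset≡⇒ShiftEq : ∀ {k m n} v w → InWindow k m v → InWindow k n w →
                    offset k m v ≡ offset k n w → ShiftEq v w (+ n ℤ.- + m)
  offset≡⇒ShiftEq -∞      -∞      _ _ _ = tt
  offset≡⇒ShiftEq {k} {m} {n} (fin a) (fin b) (m≤a , a≤m+k) (n≤b , b≤n+k) same =
    shift-by-∸ m≤a n≤b (begin
      a ∸ m       ≡⟨ ℕₚ.m≤n⇒m⊓n≡m (ℕₚ.m≤n+o⇒m∸n≤o a m a≤m+k) ⟨
      (a ∸ m) ⊓ k ≡⟨ ℕₚ.suc-injective same ⟩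
      (b ∸ n) ⊓ k ≡⟨ ℕₚ.m≤n⇒m⊓n≡m (ℕₚ.m≤n+o⇒m∸n≤o b n b≤n+k) ⟩
      b ∸ n       ∎)

  module _ (E : Encoder) (g : ℕ → ℕ) (t : ℕ) where

    private
      value : B t → String → ℕ⁻∞
      value G = f E (proj₁ G)

    boundarySubset : B t → Subset t
    boundarySubset G = labelSubset t (Λ (proj₁ G))

    Λ≈ˢboundarySubset : ∀ G → Λ (proj₁ G) ≈ˢ toLabels (boundarySubset G)
    Λ≈ˢboundarySubset G = toLabels-labelSubset (proj₂ G)

    -- Encodings are indexed through the boundary subset rather than through
    -- Λ(G): equivalent label lists may list 𝓒(Λ(G)) in different orders.
    encodings : Subset t → List String
    encodings S = C E (toLabels S)

    length-encodings≤size : ∀ S → length (encodings S) ≤ size E t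
    length-encodings≤size S = ≤-foldr-⊔ (∈-map⁺ (length ∘ encodings) (∈-allSubsets S))

    position : ∀ S {R} → R ∈ encodings S → Fin (size E t)
    position S R∈ = inject≤ (index R∈) (length-encodings≤size S)

    finiteValues : B t → List ℕ
    finiteValues G = mapMaybe (finite ∘ value G) (C E (Λ (proj₁ G)))

    reference : B t → ℕ
    reference G = minimum (finiteValues G)

    reference-window : Confined g E → ∀ G R → R ∈ C E (Λ (proj₁ G)) →
                       InWindow (g t) (reference G) (value G R)
    reference-window confined G R R∈ with value G R in valueR
    ... | -∞    = tt
    ... | fin a = minimum-≤ a∈ , attained (∈-mapMaybe⁻ _ _ (minimum-∈ a∈))
      where
        a∈ : a ∈ finiteValues G
        a∈ = ∈-mapMaybe⁺ (finite ∘ value G) R∈ (cong finite valueR)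

        attained : ∃[ R′ ] (R′ ∈ C E (Λ (proj₁ G)) × finite (value G R′) ≡ just (reference G)) →
                   a ≤ reference G + g t
        attained (R′ , R′∈ , valueR′) =
          confined t G R R′ a (reference G) R∈ R′∈ valueR (finite-just valueR′)

    valueAt : B t → Fin (size E t) → ℕ⁻∞
    valueAt G p = maybe (value G) -∞ (lookupMaybe (encodings (boundarySubset G)) (toℕ p))

    valueAt-position : ∀ G {S R} → boundarySubset G ≡ S → (R∈ : R ∈ encodings S) →
                       valueAt G (position S R∈) ≡ value G R
    valueAt-position G {S} refl R∈
      rewrite Finₚ.toℕ-inject≤ (index R∈) (length-encodings≤size S)
            | lookupMaybe-index R∈ = refl

    valueCode : B t → Fin (size E t) → Fin (g t + 2)
    valueCode G p = fromℕ< (offset<k+2 (g t) (reference G) (valueAt G p))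

    valueCode-position : ∀ G {S R} → boundarySubset G ≡ S → (R∈ : R ∈ encodings S) →
                         toℕ (valueCode G (position S R∈)) ≡ offset (g t) (reference G) (value G R)
    valueCode-position G {S} {R} same R∈ = begin
      toℕ (valueCode G (position S R∈))
        ≡⟨ Finₚ.toℕ-fromℕ< _ ⟩
      offset (g t) (reference G) (valueAt G (position S R∈))
        ≡⟨ cong (offset _ _) (valueAt-position G same R∈) ⟩
      offset (g t) (reference G) (value G R)
        ∎

    encoderKey : B t → Fin ((g t + 2) ^ size E t * 2 ^ t)
    encoderKey G = combine (funToFin (valueCode G)) (subsetIndex (boundarySubset G))

    encoderClassifier : Confined g E →
      Classifier (B t) (λ G₁ G₂ → G₁ ≡[ E , t ] G₂) ((g t + 2) ^ size E t * 2 ^ t)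
    encoderClassifier confined = encoderKey , separates
      where
        separates : ∀ G₁ G₂ → encoderKey G₁ ≡ encoderKey G₂ → G₁ ≡[ E , t ] G₂
        separates G₁ G₂ same = sameΛ , + reference G₂ ℤ.- + reference G₁ , shift
          where
            sameParts : funToFin (valueCode G₁) ≡ funToFin (valueCode G₂)
                      × subsetIndex (boundarySubset G₁) ≡ subsetIndex (boundarySubset G₂)
            sameParts = Finₚ.combine-injective _ _ _ _ same

            sameCodes : valueCode G₁ ≗ valueCode G₂
            sameCodes = funToFin-injective (proj₁ sameParts)

            sameSubset : boundarySubset G₁ ≡ boundarySubset G₂
            sameSubset = subsetIndex-injective (proj₂ sameParts)

            sameΛ : Λ (proj₁ G₁) ≈ˢ Λ (proj₁ G₂)
            sameΛ l = ⇔.trans (Λ≈ˢboundarySubset G₁ l)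
                        (subst (λ S → l ∈ toLabels S ⇔ l ∈ Λ (proj₁ G₂)) (≡.sym sameSubset)
                               (⇔.sym (Λ≈ˢboundarySubset G₂ l)))

            shift : ∀ R → R ∈ C E (Λ (proj₁ G₁)) →
                    ShiftEq (value G₁ R) (value G₂ R) (+ reference G₂ ℤ.- + reference G₁)
            shift R R∈ = offset≡⇒ShiftEq (value G₁ R) (value G₂ R)
              (reference-window confined G₁ R R∈)
              (reference-window confined G₂ R (Equivalence.to (C-resp E sameΛ R) R∈))
              (begin
                offset (g t) (reference G₁) (value G₁ R)
                  ≡⟨ valueCode-position G₁ refl R∈′ ⟨
                toℕ (valueCode G₁ p)
                  ≡⟨ cong toℕ (sameCodes p) ⟩
                toℕ (valueCode G₂ p)
                  ≡⟨ valueCode-position G₂ (≡.sym sameSubset) R∈′ ⟩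
                offset (g t) (reference G₂) (value G₂ R)
                  ∎)
              where
                R∈′ : R ∈ encodings (boundarySubset G₁)
                R∈′ = Equivalence.to (C-resp E (Λ≈ˢboundarySubset G₁) R) R∈

                p : Fin (size E t)
                p = position (boundarySubset G₁) R∈′

lemma3p5 : (𝓖 : Graph → Set) → MSOExpressible 𝓖 →
    (E : Encoder) (g : ℕ → ℕ) (t : ℕ) → Confined g E →
    (r : ℕ) → ExactlyClasses (B t) (λ G₁ G₂ → G₁ ≡𝓖[ 𝓖 , t ] G₂) r →
    AtMostClasses (B t) (λ G₁ G₂ → G₁ ≡[ E , 𝓖 , t ] G₂) (bound E g t r)
    × AtMostClasses (F t) (λ G₁ G₂ → proj₁ G₁ ≡[ E , 𝓖 , t ] proj₁ G₂) (bound E g t r)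
-- MSO-expressibility is what makes r_{𝓖,t} finite; here that finiteness is
-- already supplied by the hypothesis on r.
lemma3p5 𝓖 _ E g t confined r 𝓖-classes = onB ,′ λ Gs → onB (proj₁ ∘ Gs)
  where
    𝓖-classifier : Classifier (B t) (λ G₁ G₂ → G₁ ≡𝓖[ 𝓖 , t ] G₂) r
    𝓖-classifier = exactlyClasses⇒classifier 𝓖-classes (≡𝓖-euclidean {𝓖})

    onB : AtMostClasses (B t) (λ G₁ G₂ → G₁ ≡[ E , 𝓖 , t ] G₂) (bound E g t r)
    onB = classifier⇒atMostClasses (classifier-× (encoderClassifier E g t confined) 𝓖-classifier)
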